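{- Let $\chi$ be the coloring of pairs of distinct elements of $[\omega]^2$ given by $\chi(\{a,b\},\{c,d\})=\{a,b,c,d\}$, and let $\mathcal{I}$ be the collection of all $X\subseteq[\omega]^2$ for which there is $N\in\omega$ such that no $A\subseteq\omega$ with $|A|\geq N$ satisfies $[A]^2\subseteq X$. Then $\mathcal{I}$ is an ideal on $[\omega]^2$ and it contains every subset of $[\omega]^2$ which is polychromatic for $\chi$.
   Context: $[\omega]^2$ is the set of $2$-element subsets of $\omega$; for $A\subseteq\omega$, $[A]^2$ is the set of $2$-element subsets of $A$. A set $Y\subseteq[\omega]^2$ is polychromatic for $\chi$ if distinct pairs of distinct members of $Y$ receive distinct colors. An ideal is a family closed under subsets and finite unions. -}

module Defs where

open import Level using (Level; suc; zero)
open import Data.Nat using (ℕ; _<_)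
open import Data.Fin using (Fin)
open import Data.Empty using (⊥)
open import Data.Sum using (_⊎_)
open import Data.Product using (Σ; ∃; _×_)
open import Relation.Nullary using (¬_)
open import Relation.Binary.PropositionalEquality using (_≡_; _≢_)
open import Function.Definitions using (Injective)

-- An element of [ω]² : a 2-element subset {lo, hi} of ω, written with lo < hi.
record Pair : Set where
  constructor ⟪_,_∣_⟫
  field
    lo hi : ℕ
    lo<hi : lo < hi
open Pair public

_∈ₚ_ : ℕ → Pair → Set
x ∈ₚ p = x ≡ lo p ⊎ x ≡ hi p

SubsetΩ : Set₁
SubsetΩ = ℕ → Set

SubsetΩ² : Set₁
SubsetΩ² = Pair → Set

_⊆²_ : SubsetΩ² → SubsetΩ² → Set
X ⊆² Y = ∀ p → X p → Y p

∅² : SubsetΩ²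
∅² _ = ⊥

_∪²_ : SubsetΩ² → SubsetΩ² → SubsetΩ²
(X ∪² Y) p = X p ⊎ Y p

Square⊆ : SubsetΩ → SubsetΩ² → Set
Square⊆ A X = ∀ p → A (lo p) → A (hi p) → X p

CardGe : SubsetΩ → ℕ → Set
CardGe A N = Σ (Fin N → ℕ) λ f → Injective _≡_ _≡_ f × (∀ i → A (f i))

χ : Pair → Pair → SubsetΩ
χ p q x = x ∈ₚ p ⊎ x ∈ₚ q

SameColour : SubsetΩ → SubsetΩ → Set
SameColour C D = ∀ x → (C x → D x) × (D x → C x)

SameUnorderedPair : Pair → Pair → Pair → Pair → Set
SameUnorderedPair p q r s = (p ≡ r × q ≡ s) ⊎ (p ≡ s × q ≡ r)

Polychromatic : SubsetΩ² → Set
Polychromatic Y = ∀ p q r s → Y p → Y q → Y r → Y s → p ≢ q → r ≢ s →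
  ¬ SameUnorderedPair p q r s → ¬ SameColour (χ p q) (χ r s)

IsIdeal : (SubsetΩ² → Set₁) → Set₁
IsIdeal 𝓘 = 𝓘 ∅²
  × (∀ X Y → X ⊆² Y → 𝓘 Y → 𝓘 X)
  × (∀ X Y → 𝓘 X → 𝓘 Y → 𝓘 (X ∪² Y))

𝓘 : SubsetΩ² → Set₁
𝓘 X = Σ ℕ λ N → ∀ (A : SubsetΩ) → CardGe A N → ¬ Square⊆ A X

module Submission where

-- We read "[A]² ⊆ X" graph-theoretically: X is the graph on
-- ω joining a and b when the pair {a,b} lies in X, and [A]² ⊆ X says that A
-- is a clique of that graph (lemmas square⇒joined and joined-clique⇒square).
-- Cliques are handled as duplicate-free lists whose pairs are all joined,
-- which translate back into cardinality witnesses by listCard.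
--
-- Closure of 𝓘 under finite unions is then the two-colour finite Ramsey
-- theorem (module Ramsey, proved for lists over any type by the classical
-- Erdős–Szekeres recursion): a clique of size R(N,M) in the graph of X ∪ Y
-- contains an N-clique of X or an M-clique of Y.  Finally a polychromatic Y has bound 4: four
-- distinct points a,b,c,d with [A]² ⊆ Y give the distinct pairs of pairs
-- {ab,cd} and {ac,bd} of Y, both coloured {a,b,c,d} (lemma pairings-clash).

open import Defs
open import Level using (0ℓ)
open import Function using (_∘_)
open import Data.Empty using (⊥-elim)
open import Data.Product using (Σ; _×_; _,_; proj₂)
open import Data.Sum as Sum using (_⊎_; inj₁; inj₂; [_,_]; swap)
open import Data.Nat using (ℕ; zero; suc; _+_; _≤_; _<_; z≤n; s≤s; _≤?_)
open import Data.Nat.Properties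
  using (≤-trans; ≤-reflexive; +-suc; +-mono-<; <⇒≱; ≰⇒>; <-cmp; <-irrefl; <-asym; <-irrelevant; <⇒≢)
open import Data.Fin as Fin using (Fin; inject≤)
open import Data.Fin.Patterns using (0F; 1F; 2F; 3F)
open import Data.Fin.Properties using (inject≤-injective; 0≢1+n)
open import Data.List using (List; []; _∷_; length; lookup; tabulate)
open import Data.List.Properties using (length-tabulate)
open import Data.List.Membership.Propositional using (_∈_)
open import Data.List.Membership.Propositional.Properties using (∈-lookup)
open import Data.List.Relation.Unary.Any using (here; there)
open import Data.List.Relation.Unary.All as All using (All; []; _∷_)
open import Data.List.Relation.Unary.AllPairs as AllPairs using (AllPairs; []; _∷_)
import Data.List.Relation.Unary.AllPairs.Properties as AllPairsₚ
open import Data.List.Relation.Unary.Unique.Propositional using (Unique)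
open import Data.List.Relation.Binary.Sublist.Propositional using (_⊆_; []; _∷_; _∷ʳ_; minimum; ⊆-trans)
open import Data.List.Relation.Binary.Sublist.Propositional.Properties using (All-resp-⊆)
open import Relation.Nullary using (¬_; yes; no)
open import Relation.Binary.Core using (Rel)
open import Relation.Binary.Definitions using (Symmetric; tri<; tri≈; tri>)
open import Relation.Binary.Construct.Union using (_∪_)
open import Relation.Binary.PropositionalEquality using (_≡_; _≢_; refl; sym; cong; subst; subst₂)

-- If a + b ≤ c + d then a ≤ c or b ≤ d: the counting step of the Ramsey recursion.
+-≤-split : ∀ {a b c d} → a + b ≤ c + d → a ≤ c ⊎ b ≤ d
+-≤-split {a} {b} {c} {d} a+b≤c+d with a ≤? c | b ≤? d
... | yes a≤c | _       = inj₁ a≤c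
... | no _    | yes b≤d = inj₂ b≤d
... | no a≰c  | no b≰d  = ⊥-elim (<⇒≱ (+-mono-< (≰⇒> a≰c) (≰⇒> b≰d)) a+b≤c+d)

allPairs-⊆ : ∀ {A : Set} {R : Rel A 0ℓ} {xs ys} → ys ⊆ xs → AllPairs R xs → AllPairs R ys
allPairs-⊆ []       []       = []
allPairs-⊆ (_ ∷ʳ τ) (_ ∷ rs) = allPairs-⊆ τ rs
allPairs-⊆ (refl ∷ τ) (r ∷ rs) = All-resp-⊆ τ r ∷ allPairs-⊆ τ rs

allPairs-∈ : ∀ {A : Set} {R : Rel A 0ℓ} {xs a b} → Symmetric R → AllPairs R xs →
             a ∈ xs → b ∈ xs → a ≢ b → R a b
allPairs-∈ _     (_ ∷ _)  (here refl) (here refl) a≢b = ⊥-elim (a≢b refl)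
allPairs-∈ _     (r ∷ _)  (here refl) (there b∈)  _   = All.lookup r b∈
allPairs-∈ R-sym (r ∷ _)  (there a∈)  (here refl) _   = R-sym (All.lookup r a∈)
allPairs-∈ R-sym (_ ∷ rs) (there a∈)  (there b∈)  a≢b = allPairs-∈ R-sym rs a∈ b∈ a≢b

module Ramsey {A : Set} (P Q : Rel A 0ℓ) where

  -- the binomial upper bound R(n,m) ≤ R(n-1,m) + R(n,m-1) + 1
  ramseyBound : ℕ → ℕ → ℕ
  ramseyBound zero    _       = 0
  ramseyBound (suc n) zero    = 0
  ramseyBound (suc n) (suc m) = suc (ramseyBound n (suc m) + ramseyBound (suc n) m)

  record Split (x : A) (xs : List A) : Set where
    field
      left right : List A
      left⊆      : left ⊆ xs
      right⊆     : right ⊆ xs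
      left-P     : All (P x) left
      right-Q    : All (Q x) right
      covers     : length xs ≤ length left + length right
  open Split

  split : ∀ x xs → All ((P ∪ Q) x) xs → Split x xs
  split x [] [] = record
    { left = [] ; right = [] ; left⊆ = [] ; right⊆ = []
    ; left-P = [] ; right-Q = [] ; covers = z≤n }
  split x (y ∷ xs) (inj₁ p ∷ cs) = let s = split x xs cs in record
    { left = y ∷ left s ; right = right s ; left⊆ = refl ∷ left⊆ s ; right⊆ = y ∷ʳ right⊆ s
    ; left-P = p ∷ left-P s ; right-Q = right-Q s ; covers = s≤s (covers s) }
  split x (y ∷ xs) (inj₂ q ∷ cs) = let s = split x xs cs in record
    { left = left s ; right = y ∷ right s ; left⊆ = y ∷ʳ left⊆ s ; right⊆ = refl ∷ right⊆ s
    ; left-P = left-P s ; right-Q = q ∷ right-Q s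
    ; covers = ≤-trans (s≤s (covers s)) (≤-reflexive (sym (+-suc (length (left s)) (length (right s))))) }

  Homogeneous : ℕ → ℕ → List A → Set
  Homogeneous n m xs = Σ (List A) λ ys → ys ⊆ xs ×
    (n ≤ length ys × AllPairs P ys ⊎ m ≤ length ys × AllPairs Q ys)

  ramsey : ∀ n m xs → AllPairs (P ∪ Q) xs → ramseyBound n m ≤ length xs → Homogeneous n m xs
  ramsey zero    _       xs _ _ = [] , minimum xs , inj₁ (z≤n , [])
  ramsey (suc n) zero    xs _ _ = [] , minimum xs , inj₂ (z≤n , [])
  ramsey (suc n) (suc m) (x ∷ xs) (cx ∷ cs) (s≤s bound≤) = fromSplit (split x xs cx)
    where
    growP : (s : Split x xs) → Homogeneous n (suc m) (left s) → Homogeneous (suc n) (suc m) (x ∷ xs)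
    growP s (ys , τ , inj₁ (n≤ , ps)) =
      x ∷ ys , refl ∷ ⊆-trans τ (left⊆ s) , inj₁ (s≤s n≤ , All-resp-⊆ τ (left-P s) ∷ ps)
    growP s (ys , τ , inj₂ qs) = ys , x ∷ʳ ⊆-trans τ (left⊆ s) , inj₂ qs

    growQ : (s : Split x xs) → Homogeneous (suc n) m (right s) → Homogeneous (suc n) (suc m) (x ∷ xs)
    growQ s (ys , τ , inj₁ ps) = ys , x ∷ʳ ⊆-trans τ (right⊆ s) , inj₁ ps
    growQ s (ys , τ , inj₂ (m≤ , qs)) =
      x ∷ ys , refl ∷ ⊆-trans τ (right⊆ s) , inj₂ (s≤s m≤ , All-resp-⊆ τ (right-Q s) ∷ qs)

    -- one side of the split is long enough for the recursive call
    fromSplit : Split x xs → Homogeneous (suc n) (suc m) (x ∷ xs)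
    fromSplit s with +-≤-split (≤-trans bound≤ (covers s))
    ... | inj₁ long = growP s (ramsey n (suc m) (left s) (allPairs-⊆ (left⊆ s) cs) long)
    ... | inj₂ long = growQ s (ramsey (suc n) m (right s) (allPairs-⊆ (right⊆ s) cs) long)

lookup-injective : ∀ {A : Set} {xs : List A} {i j} → Unique xs → lookup xs i ≡ lookup xs j → i ≡ j
lookup-injective {xs = _ ∷ _} {Fin.zero}  {Fin.zero}  _        _ = refl
lookup-injective {xs = _ ∷ _} {Fin.zero}  {Fin.suc j} (x∉ ∷ _) e = ⊥-elim (All.lookup x∉ (∈-lookup j) e)
lookup-injective {xs = _ ∷ _} {Fin.suc i} {Fin.zero}  (x∉ ∷ _) e = ⊥-elim (All.lookup x∉ (∈-lookup i) (sym e))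
lookup-injective {xs = _ ∷ _} {Fin.suc i} {Fin.suc j} (_ ∷ u)  e = cong Fin.suc (lookup-injective u e)

listCard : ∀ {n ys} → Unique ys → n ≤ length ys → CardGe (_∈ ys) n
listCard {ys = ys} u n≤ =
  (λ i → lookup ys (inject≤ i n≤)) ,
  (λ e → inject≤-injective n≤ n≤ _ _ (lookup-injective u e)) ,
  (λ i → ∈-lookup (inject≤ i n≤))

data Spans (p : Pair) (a b : ℕ) : Set where
  forward  : lo p ≡ a → hi p ≡ b → Spans p a b
  backward : lo p ≡ b → hi p ≡ a → Spans p a b

spans-sym : ∀ {p a b} → Spans p a b → Spans p b a
spans-sym (forward  lo≡ hi≡) = backward lo≡ hi≡
spans-sym (backward lo≡ hi≡) = forward  lo≡ hi≡

spanning : ∀ {a b} → a ≢ b → Σ Pair λ p → Spans p a b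
spanning {a} {b} a≢b with <-cmp a b
... | tri< a<b _ _ = ⟪ a , b ∣ a<b ⟫ , forward refl refl
... | tri≈ _ a≡b _ = ⊥-elim (a≢b a≡b)
... | tri> _ _ b<a = ⟪ b , a ∣ b<a ⟫ , backward refl refl

spans-∈ : ∀ {p a b x} → Spans p a b → x ∈ₚ p → x ≡ a ⊎ x ≡ b
spans-∈ (forward refl refl) x∈p = x∈p
spans-∈ (backward refl refl) x∈p = swap x∈p

spans-∋ : ∀ {p a b x} → Spans p a b → x ≡ a ⊎ x ≡ b → x ∈ₚ p
spans-∋ (forward refl refl) x≡ = x≡
spans-∋ (backward refl refl) x≡ = swap x≡

spans-unique : ∀ {p q} → Spans q (lo p) (hi p) → q ≡ p
spans-unique {⟪ a , b ∣ h ⟫} {⟪ _ , _ ∣ h′ ⟫} (forward refl refl) = cong ⟪ a , b ∣_⟫ (<-irrelevant h′ h)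
spans-unique {p} {q} (backward lo≡ hi≡) =
  ⊥-elim (<-asym (lo<hi q) (subst₂ _<_ (sym hi≡) (sym lo≡) (lo<hi p)))

square-spans : ∀ {A X p a b} → Square⊆ A X → Spans p a b → A a → A b → X p
square-spans {p = p} A²⊆X (forward refl refl) a∈A b∈A = A²⊆X p a∈A b∈A
square-spans {p = p} A²⊆X (backward refl refl) a∈A b∈A = A²⊆X p b∈A a∈A

Joined : SubsetΩ² → ℕ → ℕ → Set
Joined X a b = Σ Pair λ p → Spans p a b × X p

joined-sym : ∀ {X} → Symmetric (Joined X)
joined-sym (p , sp , p∈X) = p , spans-sym sp , p∈X

joined⇒≢ : ∀ {X a b} → Joined X a b → a ≢ b
joined⇒≢ (p , forward refl refl , _) a≡b = <-irrefl a≡b (lo<hi p)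
joined⇒≢ (p , backward refl refl , _) a≡b = <-irrefl (sym a≡b) (lo<hi p)

joined-∪ : ∀ {X Y a b} → Joined (X ∪² Y) a b → (Joined X ∪ Joined Y) a b
joined-∪ (p , sp , inj₁ p∈X) = inj₁ (p , sp , p∈X)
joined-∪ (p , sp , inj₂ p∈Y) = inj₂ (p , sp , p∈Y)

square⇒joined : ∀ {A X a b} → Square⊆ A X → A a → A b → a ≢ b → Joined X a b
square⇒joined A²⊆X a∈A b∈A a≢b =
  let (p , sp) = spanning a≢b in p , sp , square-spans A²⊆X sp a∈A b∈A

joined-clique⇒square : ∀ {X ys} → AllPairs (Joined X) ys → Square⊆ (_∈ ys) X
joined-clique⇒square {X} js p lo∈ hi∈ =
  let (q , sq , q∈X) = allPairs-∈ joined-sym js lo∈ hi∈ (<⇒≢ (lo<hi p))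
  in subst X (spans-unique sq) q∈X

Bounds : ℕ → SubsetΩ² → Set₁
Bounds N X = ∀ (A : SubsetΩ) → CardGe A N → ¬ Square⊆ A X

bound-joined : ∀ {N X ys} → Bounds N X → AllPairs (Joined X) ys → ¬ N ≤ length ys
bound-joined {ys = ys} bnd js N≤ =
  bnd (_∈ ys) (listCard (AllPairs.map joined⇒≢ js) N≤) (joined-clique⇒square js)

joined-list : ∀ {A X N} → CardGe A N → Square⊆ A X →
              Σ (List ℕ) λ xs → length xs ≡ N × AllPairs (Joined X) xs
joined-list (f , f-inj , f∈A) A²⊆X =
  tabulate f , length-tabulate f ,
  AllPairsₚ.tabulate⁺ (λ i≢j → square⇒joined A²⊆X (f∈A _) (f∈A _) (i≢j ∘ f-inj))

-- Two distinct points would span a pair of the empty family.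
𝓘-∅ : 𝓘 ∅²
𝓘-∅ = 2 , λ A (f , f-inj , f∈A) A²⊆∅ →
  proj₂ (proj₂ (square⇒joined A²⊆∅ (f∈A 0F) (f∈A 1F) (0≢1+n ∘ f-inj)))

𝓘-⊆ : ∀ X Y → X ⊆² Y → 𝓘 Y → 𝓘 X
𝓘-⊆ X Y X⊆Y (N , bnd) = N , λ A card A²⊆X → bnd A card (λ p a∈A b∈A → X⊆Y p (A²⊆X p a∈A b∈A))

-- Closure under unions is the finite Ramsey theorem for the graphs of X and Y.
𝓘-∪ : ∀ X Y → 𝓘 X → 𝓘 Y → 𝓘 (X ∪² Y)
𝓘-∪ X Y (N , bndX) (M , bndY) = ramseyBound N M , noSquare
  where
  open Ramsey (Joined X) (Joined Y)
  noSquare : Bounds (ramseyBound N M) (X ∪² Y)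
  noSquare A card A²⊆X∪Y with joined-list card A²⊆X∪Y
  ... | xs , len , js with ramsey N M xs (AllPairs.map joined-∪ js) (≤-reflexive (sym len))
  ...   | _ , _ , inj₁ (N≤ , jsX) = bound-joined bndX jsX N≤
  ...   | _ , _ , inj₂ (M≤ , jsY) = bound-joined bndY jsY M≤

-- Regrouping {a,b} ∪ {c,d} as {a,c} ∪ {b,d}.
⊎-interchange : ∀ {P Q R S : Set} → (P ⊎ Q) ⊎ (R ⊎ S) → (P ⊎ R) ⊎ (Q ⊎ S)
⊎-interchange (inj₁ (inj₁ p)) = inj₁ (inj₁ p)
⊎-interchange (inj₁ (inj₂ q)) = inj₂ (inj₁ q)
⊎-interchange (inj₂ (inj₁ r)) = inj₁ (inj₂ r)
⊎-interchange (inj₂ (inj₂ s)) = inj₂ (inj₂ s)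

separated : ∀ {p q a b c d} → Spans p a b → Spans q c d → a ≢ c → a ≢ d → p ≢ q
separated sp sq a≢c a≢d refl = [ a≢c , a≢d ] (spans-∈ sq (spans-∋ sp (inj₁ refl)))

χ-regroup : ∀ {a b c d p q r s} → Spans p a b → Spans q c d → Spans r a c → Spans s b d →
            ∀ x → χ p q x → χ r s x
χ-regroup sp sq sr ss x =
  Sum.map (spans-∋ sr) (spans-∋ ss) ∘ ⊎-interchange ∘ Sum.map (spans-∈ sp) (spans-∈ sq)

pairings-clash : ∀ {a b c d p q r s} → a ≢ b → a ≢ c → a ≢ d → b ≢ c →
  Spans p a b → Spans q c d → Spans r a c → Spans s b d →
  p ≢ q × r ≢ s × ¬ SameUnorderedPair p q r s × SameColour (χ p q) (χ r s)
pairings-clash a≢b a≢c a≢d b≢c sp sq sr ss =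
  separated sp sq a≢c a≢d ,
  separated sr ss a≢b a≢d ,
  [ (λ (p≡r , _) → separated (spans-sym sp) sr (a≢b ∘ sym) b≢c p≡r)
  , (λ (p≡s , _) → separated sp ss a≢b a≢d p≡s) ] ,
  λ x → χ-regroup sp sq sr ss x , χ-regroup sr ss sp sq x

square-not-polychromatic : ∀ {A Y} → CardGe A 4 → Square⊆ A Y → ¬ Polychromatic Y
square-not-polychromatic {Y = Y} (f , f-inj , f∈A) A²⊆Y poly =
  let (p , sp , p∈Y) = edge 0F 1F (λ ())
      (q , sq , q∈Y) = edge 2F 3F (λ ())
      (r , sr , r∈Y) = edge 0F 2F (λ ())
      (s , ss , s∈Y) = edge 1F 3F (λ ())
      (p≢q , r≢s , pq≠rs , same) =
        pairings-clash (apart 0F 1F (λ ())) (apart 0F 2F (λ ())) (apart 0F 3F (λ ()))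
                       (apart 1F 2F (λ ())) sp sq sr ss
  in poly p q r s p∈Y q∈Y r∈Y s∈Y p≢q r≢s pq≠rs same
  where
  apart : ∀ i j → i ≢ j → f i ≢ f j
  apart i j i≢j = i≢j ∘ f-inj
  edge : ∀ i j → i ≢ j → Joined Y (f i) (f j)
  edge i j i≢j = square⇒joined A²⊆Y (f∈A i) (f∈A j) (apart i j i≢j)

mainTheorem20 : IsIdeal 𝓘 × (∀ (Y : SubsetΩ²) → Polychromatic Y → 𝓘 Y)
mainTheorem20 =
  (𝓘-∅ , 𝓘-⊆ , 𝓘-∪) ,
  λ Y poly → 4 , λ A card A²⊆Y → square-not-polychromatic card A²⊆Y poly
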